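{- Let $w \in \mathfrak{S}_n$ and let $I$ be a nonempty interval of $w$. Let $u$ be the permutation of $[1,|I|]$ order-isomorphic to the subword of $w$ consisting of the letters of $I$ (in the order they appear in $w$). Then the principal order ideal $\{J \in \mathcal{P}(w) : J \subseteq I\}$ of $I$ in $\mathcal{P}(w)$ is isomorphic to $\mathcal{P}(u)$, and the principal order ideal of $I$ in $\overline{\mathcal{P}}(w)$ is isomorphic to $\overline{\mathcal{P}}(u)$.
   Context: For $w \in \mathfrak{S}_n$ in one-line notation $w(1)\cdots w(n)$, an interval of $w$ is a set of consecutive integers $[h,h+j]$ (possibly empty) with $\{w(t) : t \in [i,i+j]\} = [h,h+j]$ for some $i$. $\mathcal{P}(w)$ is the set of nonempty intervals of $w$ ordered by inclusion, and $\overline{\mathcal{P}}(w)$ is $\mathcal{P}(w)$ with a minimum element $\widehat{0}$ (the empty interval) adjoined. The principal order ideal of $x$ in a poset $P$ is $\{y \in P : y \le x\}$. -}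

module Defs where

open import Data.Nat using (ℕ; _≤_; _<_; _+_)
open import Data.Fin using (Fin; toℕ)
open import Data.Fin.Permutation using (Permutation′; _⟨$⟩ʳ_)
open import Data.Product using (Σ; ∃; _×_; _,_; proj₁; proj₂)
open import Data.Maybe using (Maybe; just; nothing)
open import Data.Empty using (⊥)
open import Relation.Binary.PropositionalEquality using (_≡_)
open import Relation.Binary.Morphism.Structures using (IsOrderIsomorphism)

-- Conventions: positions and values are 0-based (Fin n = {0,…,n-1} stands for [1,n]).
-- A permutation w ∈ 𝔖ₙ is a library permutation 'Permutation′ n', with w(t) = w ⟨$⟩ʳ t.

SubsetOfℕ : Set₁
SubsetOfℕ = ℕ → Set

_⊆_ : SubsetOfℕ → SubsetOfℕ → Set
A ⊆ B = ∀ v → A v → B v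

_≐_ : SubsetOfℕ → SubsetOfℕ → Set
A ≐ B = (A ⊆ B) × (B ⊆ A)

Range : ℕ → ℕ → SubsetOfℕ
Range h j v = (h ≤ v) × (v ≤ h + j)

IsNonemptyInterval : ∀ {n} → Permutation′ n → ℕ → ℕ → Set
IsNonemptyInterval {n} w h j =
  Σ ℕ λ i → (i + j < n) ×
    (∀ v → (Range h j v → ∃ λ (t : Fin n) → Range i j (toℕ t) × (toℕ (w ⟨$⟩ʳ t) ≡ v))
         × ((∃ λ (t : Fin n) → Range i j (toℕ t) × (toℕ (w ⟨$⟩ʳ t) ≡ v)) → Range h j v))

-- Elements of 𝒫(w): nonempty intervals, given by (h , j) meaning [h, h+j].
Interval : ∀ {n} → Permutation′ n → Set
Interval w = Σ (ℕ × ℕ) λ hj → IsNonemptyInterval w (proj₁ hj) (proj₂ hj)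

⟦_⟧ : ∀ {n} {w : Permutation′ n} → Interval w → SubsetOfℕ
⟦ ((h , j) , _) ⟧ = Range h j

card : ∀ {n} {w : Permutation′ n} → Interval w → ℕ
card ((h , j) , _) = j + 1

_≤P_ : ∀ {n} {w : Permutation′ n} → Interval w → Interval w → Set
_≤P_ {w = w} I J = ⟦_⟧ {w = w} I ⊆ ⟦_⟧ {w = w} J

_≈P_ : ∀ {n} {w : Permutation′ n} → Interval w → Interval w → Set
_≈P_ {w = w} I J = ⟦_⟧ {w = w} I ≐ ⟦_⟧ {w = w} J

-- 𝒫̄(w) = 𝒫(w) with 0̂ = the empty interval adjoined (nothing ↦ ∅).
PBar : ∀ {n} → Permutation′ n → Set
PBar w = Maybe (Interval w)

⟦_⟧̄ : ∀ {n} {w : Permutation′ n} → PBar w → SubsetOfℕ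
⟦ nothing ⟧̄ = λ _ → ⊥
⟦_⟧̄ {w = w} (just I) = ⟦_⟧ {w = w} I

_≤P̄_ : ∀ {n} {w : Permutation′ n} → PBar w → PBar w → Set
_≤P̄_ {w = w} x y = ⟦_⟧̄ {w = w} x ⊆ ⟦_⟧̄ {w = w} y

_≈P̄_ : ∀ {n} {w : Permutation′ n} → PBar w → PBar w → Set
_≈P̄_ {w = w} x y = ⟦_⟧̄ {w = w} x ≐ ⟦_⟧̄ {w = w} y

IdealP : ∀ {n} {w : Permutation′ n} → Interval w → Set
IdealP {w = w} I = Σ (Interval w) λ J → _≤P_ {w = w} J I

_≤IP_ : ∀ {n} {w : Permutation′ n} {I : Interval w} → IdealP {w = w} I → IdealP {w = w} I → Set
_≤IP_ {w = w} x y = _≤P_ {w = w} (proj₁ x) (proj₁ y)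

_≈IP_ : ∀ {n} {w : Permutation′ n} {I : Interval w} → IdealP {w = w} I → IdealP {w = w} I → Set
_≈IP_ {w = w} x y = _≈P_ {w = w} (proj₁ x) (proj₁ y)

IdealP̄ : ∀ {n} {w : Permutation′ n} → Interval w → Set
IdealP̄ {w = w} I = Σ (PBar w) λ x → _≤P̄_ {w = w} x (just I)

_≤IP̄_ : ∀ {n} {w : Permutation′ n} {I : Interval w} → IdealP̄ {w = w} I → IdealP̄ {w = w} I → Set
_≤IP̄_ {w = w} x y = _≤P̄_ {w = w} (proj₁ x) (proj₁ y)

_≈IP̄_ : ∀ {n} {w : Permutation′ n} {I : Interval w} → IdealP̄ {w = w} I → IdealP̄ {w = w} I → Set
_≈IP̄_ {w = w} x y = _≈P̄_ {w = w} (proj₁ x) (proj₁ y)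

StrictlyIncreasing : ∀ {m n} → (Fin m → Fin n) → Set
StrictlyIncreasing p = ∀ k k′ → toℕ k < toℕ k′ → toℕ (p k) < toℕ (p k′)

-- u ∈ 𝔖ₘ is order-isomorphic to the subword of w consisting of the letters of I
-- (in the order they appear in w): p lists, increasingly, exactly the positions t
-- with w(t) ∈ I, and u(k) < u(k′) iff w(p k) < w(p k′).
IsPatternOf : ∀ {n m} (w : Permutation′ n) (I : Interval w) (u : Permutation′ m) → Set
IsPatternOf {n} {m} w I u =
  Σ (Fin m → Fin n) λ p →
    StrictlyIncreasing p
    × (∀ t → (⟦_⟧ {w = w} I (toℕ (w ⟨$⟩ʳ t)) → ∃ λ k → p k ≡ t) × ((∃ λ k → p k ≡ t) → ⟦_⟧ {w = w} I (toℕ (w ⟨$⟩ʳ t))))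
    × (∀ k k′ → (toℕ (u ⟨$⟩ʳ k) < toℕ (u ⟨$⟩ʳ k′) → toℕ (w ⟨$⟩ʳ p k) < toℕ (w ⟨$⟩ʳ p k′))
              × (toℕ (w ⟨$⟩ʳ p k) < toℕ (w ⟨$⟩ʳ p k′) → toℕ (u ⟨$⟩ʳ k) < toℕ (u ⟨$⟩ʳ k′)))

{-# OPTIONS --safe #-}
-- If the values of I = [h, h+j] occupy the positions [i, i+j] of w, then the pattern u is
-- w on that block shifted down: w(i + k) = h + u(k). An interval J ⊆ I of w therefore sits
-- at positions inside the block, and J ↦ J − h is an inclusion-preserving bijection onto
-- the intervals of u, with inverse K ↦ K + h. Adjoining the empty interval to both sides
-- preserves the isomorphism because every interval is nonempty.
module Submission where

open import Defs
open import Data.Nat using (ℕ; zero; suc; _+_; _∸_; _≤_; _<_; z≤n; s≤s)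
open import Data.Nat.Properties
open import Data.Fin using (Fin; toℕ; fromℕ<)
open import Data.Fin.Properties using (toℕ-injective; toℕ<n; toℕ-fromℕ<)
open import Data.Fin.Permutation using (Permutation′; _⟨$⟩ʳ_; _⟨$⟩ˡ_; inverseˡ; inverseʳ)
open import Data.Maybe using (just; nothing)
open import Data.Product using (∃; _×_; _,_; proj₁; proj₂)
open import Data.Empty using (⊥-elim)
open import Function using (flip; _∘_)
open import Level using (0ℓ)
open import Relation.Binary using (Rel; Transitive)
open import Relation.Binary.Construct.Intersection using (_∩_)
open import Relation.Binary.PropositionalEquality
open import Relation.Binary.Morphism.Structures using (IsOrderIsomorphism)

⊆-refl : ∀ {A} → A ⊆ A
⊆-refl _ x∈A = x∈A

⊆-trans : ∀ {A B C} → A ⊆ B → B ⊆ C → A ⊆ C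
⊆-trans A⊆B B⊆C x x∈A = B⊆C x (A⊆B x x∈A)

Range-start : ∀ h j → Range h j h
Range-start h j = ≤-refl , m≤m+n h j

Range-end : ∀ h j → Range h j (h + j)
Range-end h j = m≤m+n h j , ≤-refl

Range-+⁺ : ∀ c {a b x} → Range a b x → Range (c + a) b (c + x)
Range-+⁺ c {a} {b} {x} (a≤x , x≤a+b) =
  +-monoʳ-≤ c a≤x , subst (c + x ≤_) (sym (+-assoc c a b)) (+-monoʳ-≤ c x≤a+b)

Range-+⁻ : ∀ c {a b x} → Range (c + a) b (c + x) → Range a b x
Range-+⁻ c {a} {b} {x} (c+a≤c+x , c+x≤c+a+b) =
  +-cancelˡ-≤ c _ _ c+a≤c+x , +-cancelˡ-≤ c _ _ (subst (c + x ≤_) (+-assoc c a b) c+x≤c+a+b)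

Range-∸⁺ : ∀ {c a b x} → c ≤ a → Range (a ∸ c) b x → Range a b (c + x)
Range-∸⁺ {c} {b = b} {x} c≤a x∈ = subst (λ z → Range z b (c + x)) (m+[n∸m]≡n c≤a) (Range-+⁺ c x∈)

Range-∸⁻ : ∀ {c a b x} → c ≤ a → Range a b (c + x) → Range (a ∸ c) b x
Range-∸⁻ {c} {b = b} {x} c≤a c+x∈ = Range-+⁻ c (subst (λ z → Range z b (c + x)) (sym (m+[n∸m]≡n c≤a)) c+x∈)

Range-⊆ : ∀ {i c b j} → c + b ≤ j → Range (i + c) b ⊆ Range i j
Range-⊆ {i} {c} {b} {j} c+b≤j y (i+c≤y , y≤i+c+b) =
  ≤-trans (m≤m+n i c) i+c≤y ,
  ≤-trans y≤i+c+b (subst (_≤ i + j) (sym (+-assoc i c b)) (+-monoʳ-≤ i c+b≤j))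

isOrderIsomorphism-fromRightInverse :
  ∀ {A B : Set} {_≤₁_ : Rel A 0ℓ} {_≤₂_ : Rel B 0ℓ} (f : A → B) (g : B → A) →
  Transitive _≤₂_ →
  (∀ x y → x ≤₁ y → f x ≤₂ f y) →
  (∀ x y → f x ≤₂ f y → x ≤₁ y) →
  (∀ y → f (g y) ≤₂ y × y ≤₂ f (g y)) →
  IsOrderIsomorphism (_≤₁_ ∩ flip _≤₁_) (_≤₂_ ∩ flip _≤₂_) _≤₁_ _≤₂_ f
isOrderIsomorphism-fromRightInverse f g ≤₂-trans mono cancel fg≈ = record
  { isOrderMonomorphism = record
    { isOrderHomomorphism = record
      { cong = λ {x} {y} (x≤y , y≤x) → mono x y x≤y , mono y x y≤x
      ; mono = λ {x} {y} → mono x y }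
    ; injective = λ {x} {y} (fx≤fy , fy≤fx) → cancel x y fx≤fy , cancel y x fy≤fx
    ; cancel = λ {x} {y} → cancel x y }
  ; surjective = λ y → g y , λ {z} (z≤gy , gy≤z) →
      ≤₂-trans (mono z (g y) z≤gy) (proj₁ (fg≈ y)) , ≤₂-trans (proj₂ (fg≈ y)) (mono (g y) z gy≤z) }

module _ {m} (g : Fin m → ℕ) (g-increasing : ∀ k k′ → toℕ k < toℕ k′ → g k < g k′) where

  strictlyIncreasing-spread : ∀ d {k k′ : Fin m} → toℕ k′ ≡ toℕ k + d → g k + d ≤ g k′
  strictlyIncreasing-spread zero {k} eq =
    ≤-reflexive (trans (+-identityʳ (g k)) (cong g (toℕ-injective (sym (trans eq (+-identityʳ (toℕ k)))))))
  strictlyIncreasing-spread (suc d) {k} {k′} eq = begin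
    g k + suc d    ≡⟨ +-suc (g k) d ⟩
    suc (g k + d)  ≤⟨ s≤s (strictlyIncreasing-spread d (toℕ-fromℕ< k+d<m)) ⟩
    suc (g k″)     ≤⟨ g-increasing k″ k′ (subst (_< toℕ k′) (sym (toℕ-fromℕ< k+d<m)) k+d<k′) ⟩
    g k′           ∎
    where
    open ≤-Reasoning
    k+d<k′ : toℕ k + d < toℕ k′
    k+d<k′ = ≤-reflexive (sym (trans eq (+-suc (toℕ k) d)))
    k+d<m : toℕ k + d < m
    k+d<m = <-trans k+d<k′ (toℕ<n k′)
    k″ : Fin m
    k″ = fromℕ< k+d<m

  strictlyIncreasing-into-Range : ∀ {a j} → m ≡ suc j → (∀ k → Range a j (g k)) → ∀ k → g k ≡ a + toℕ k
  strictlyIncreasing-into-Range {a} {j} m≡1+j g∈ k = ≤-antisym g[k]≤a+k a+k≤g[k]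
    where
    0<m : 0 < m
    0<m = subst (0 <_) (sym m≡1+j) (s≤s z≤n)
    j<m : j < m
    j<m = subst (j <_) (sym m≡1+j) ≤-refl
    k≤j : toℕ k ≤ j
    k≤j = ≤-pred (subst (toℕ k <_) m≡1+j (toℕ<n k))
    a+k≤g[k] : a + toℕ k ≤ g k
    a+k≤g[k] = ≤-trans (+-monoˡ-≤ (toℕ k) (proj₁ (g∈ (fromℕ< 0<m))))
                       (strictlyIncreasing-spread (toℕ k) (cong (_+ toℕ k) (sym (toℕ-fromℕ< 0<m))))
    g[k]+rest≤a+k+rest : g k + (j ∸ toℕ k) ≤ a + toℕ k + (j ∸ toℕ k)
    g[k]+rest≤a+k+rest = begin
      g k + (j ∸ toℕ k)        ≤⟨ strictlyIncreasing-spread (j ∸ toℕ k)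
                                    (trans (toℕ-fromℕ< j<m) (sym (m+[n∸m]≡n k≤j))) ⟩
      g (fromℕ< j<m)           ≤⟨ proj₂ (g∈ (fromℕ< j<m)) ⟩
      a + j                    ≡⟨ cong (a +_) (sym (m+[n∸m]≡n k≤j)) ⟩
      a + (toℕ k + (j ∸ toℕ k)) ≡⟨ sym (+-assoc a (toℕ k) _) ⟩
      a + toℕ k + (j ∸ toℕ k)  ∎
      where open ≤-Reasoning
    g[k]≤a+k : g k ≤ a + toℕ k
    g[k]≤a+k = +-cancelʳ-≤ _ _ _ g[k]+rest≤a+k+rest

Window : ∀ {n} → Permutation′ n → ℕ → ℕ → SubsetOfℕ
Window {n} w i j x = ∃ λ (t : Fin n) → Range i j (toℕ t) × toℕ (w ⟨$⟩ʳ t) ≡ x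

lowerEnd-∈ : ∀ {n} {w : Permutation′ n} (J : Interval w) → ⟦_⟧ {w = w} J (proj₁ (proj₁ J))
lowerEnd-∈ ((h , j) , _) = Range-start h j

module _ {n m} {w : Permutation′ n} {I : Interval w} {u : Permutation′ m} where

  adjoin-0̂ : (IdealP {w = w} I → Interval u) → IdealP̄ {w = w} I → PBar u
  adjoin-0̂ f (nothing , _)     = nothing
  adjoin-0̂ f (just J , J⊆I) = just (f (J , J⊆I))

  adjoin-0̂-isOrderIsomorphism : (f : IdealP {w = w} I → Interval u) →
    IsOrderIsomorphism (_≈IP_ {w = w} {I = I}) (_≈P_ {w = u}) (_≤IP_ {w = w} {I = I}) (_≤P_ {w = u}) f →
    IsOrderIsomorphism (_≈IP̄_ {w = w} {I = I}) (_≈P̄_ {w = u}) (_≤IP̄_ {w = w} {I = I}) (_≤P̄_ {w = u}) (adjoin-0̂ f)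
  adjoin-0̂-isOrderIsomorphism f f-iso =
    isOrderIsomorphism-fromRightInverse (adjoin-0̂ f) g (λ x⊆y y⊆z → ⊆-trans x⊆y y⊆z) mono cancel adjoin-0̂-g
    where
    open IsOrderIsomorphism f-iso using (surjective) renaming (mono to f-mono; cancel to f-cancel)

    g : PBar u → IdealP̄ {w = w} I
    g nothing  = nothing , λ _ ()
    g (just K) = just (proj₁ (proj₁ (surjective K))) , proj₂ (proj₁ (surjective K))

    mono : ∀ x y → _≤IP̄_ {w = w} {I = I} x y → _≤P̄_ {w = u} (adjoin-0̂ f x) (adjoin-0̂ f y)
    mono (nothing , _)     y                  _   _ ()
    mono (just J , _)      (nothing , _)      J⊆∅ = ⊥-elim (J⊆∅ _ (lowerEnd-∈ {w = w} J))
    mono (just J , J⊆I)    (just K , K⊆I)     J⊆K = f-mono {J , J⊆I} {K , K⊆I} J⊆K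

    cancel : ∀ x y → _≤P̄_ {w = u} (adjoin-0̂ f x) (adjoin-0̂ f y) → _≤IP̄_ {w = w} {I = I} x y
    cancel (nothing , _)   y                  _    _ ()
    cancel (just J , J⊆I)  (nothing , _)      fJ⊆∅ = ⊥-elim (fJ⊆∅ _ (lowerEnd-∈ {w = u} (f (J , J⊆I))))
    cancel (just J , J⊆I)  (just K , K⊆I)     fJ⊆fK = f-cancel {J , J⊆I} {K , K⊆I} fJ⊆fK

    adjoin-0̂-g : ∀ y → _≤P̄_ {w = u} (adjoin-0̂ f (g y)) y × _≤P̄_ {w = u} y (adjoin-0̂ f (g y))
    adjoin-0̂-g nothing  = (λ _ ()) , (λ _ ())
    adjoin-0̂-g (just K) = proj₂ (surjective K) (⊆-refl , ⊆-refl)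

module Block {n m} (w : Permutation′ n) (u : Permutation′ m) (h j : ℕ) (I-interval : IsNonemptyInterval w h j)
             (m≡1+j : m ≡ suc j) (u-isPattern : IsPatternOf w ((h , j) , I-interval) u) where

  I : Interval w
  I = (h , j) , I-interval

  W : Fin n → ℕ
  W t = toℕ (w ⟨$⟩ʳ t)

  U : Fin m → ℕ
  U k = toℕ (u ⟨$⟩ʳ k)

  i : ℕ
  i = proj₁ I-interval

  p : Fin m → Fin n
  p = proj₁ u-isPattern

  W-injective : ∀ {t t′} → W t ≡ W t′ → t ≡ t′
  W-injective {t} {t′} eq = begin
    t                        ≡⟨ inverseˡ w ⟨
    w ⟨$⟩ˡ (w ⟨$⟩ʳ t)        ≡⟨ cong (w ⟨$⟩ˡ_) (toℕ-injective eq) ⟩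
    w ⟨$⟩ˡ (w ⟨$⟩ʳ t′)       ≡⟨ inverseˡ w ⟩
    t′                       ∎
    where open ≡-Reasoning

  position∈block : ∀ t → Range h j (W t) → Range i j (toℕ t)
  position∈block t W[t]∈I with proj₁ (proj₂ (proj₂ I-interval) (W t)) W[t]∈I
  ... | t′ , t′∈ , W[t′]≡W[t] rewrite W-injective W[t′]≡W[t] = t′∈

  value∈I : ∀ t → Range i j (toℕ t) → Range h j (W t)
  value∈I t t∈ = proj₂ (proj₂ (proj₂ I-interval) (W t)) (t , t∈ , refl)

  block-in-image-p : ∀ t → Range i j (toℕ t) → ∃ λ k → p k ≡ t
  block-in-image-p t t∈ = proj₁ (proj₁ (proj₂ (proj₂ u-isPattern)) t) (value∈I t t∈)

  position-p : ∀ k → toℕ (p k) ≡ i + toℕ k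
  position-p = strictlyIncreasing-into-Range (λ k → toℕ (p k)) (proj₁ (proj₂ u-isPattern)) m≡1+j
    (λ k → position∈block (p k) (proj₂ (proj₁ (proj₂ (proj₂ u-isPattern)) (p k)) (k , refl)))

  value-p : ∀ k → W (p k) ≡ h + U k
  value-p k = begin
    W (p k)                 ≡⟨ cong (W ∘ p) (inverseˡ u) ⟨
    W (p (u ⟨$⟩ˡ (u ⟨$⟩ʳ k))) ≡⟨ σ-translation (u ⟨$⟩ʳ k) ⟩
    h + U k                 ∎
    where
    open ≡-Reasoning
    -- σ = w ∘ p ∘ u⁻¹ is increasing with values in I, hence a translation.
    σ : Fin m → ℕ
    σ y = W (p (u ⟨$⟩ˡ y))
    σ-increasing : ∀ y y′ → toℕ y < toℕ y′ → σ y < σ y′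
    σ-increasing y y′ y<y′ = proj₁ (proj₂ (proj₂ (proj₂ u-isPattern)) (u ⟨$⟩ˡ y) (u ⟨$⟩ˡ y′))
      (subst₂ (λ a b → toℕ a < toℕ b) (sym (inverseʳ u)) (sym (inverseʳ u)) y<y′)
    σ-translation : ∀ y → σ y ≡ h + toℕ y
    σ-translation = strictlyIncreasing-into-Range σ σ-increasing m≡1+j
      (λ y → proj₂ (proj₁ (proj₂ (proj₂ u-isPattern)) (p (u ⟨$⟩ˡ y))) (u ⟨$⟩ˡ y , refl))

  window-u⇒w : ∀ {c b v} → Window u c b v → Window w (i + c) b (h + v)
  window-u⇒w {c} {b} (k , k∈ , refl) =
    p k , subst (Range (i + c) b) (sym (position-p k)) (Range-+⁺ i k∈) , value-p k

  window-w⇒u : ∀ {c b x} → c + b ≤ j → Window w (i + c) b x → ∃ λ v → x ≡ h + v × Window u c b v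
  window-w⇒u {c} {b} c+b≤j (t , t∈ , refl) with block-in-image-p t (Range-⊆ c+b≤j (toℕ t) t∈)
  ... | k , refl = U k , value-p k , k , Range-+⁻ i (subst (Range (i + c) b) (position-p k) t∈) , refl

  Ideal : Set
  Ideal = IdealP {w = w} I

  lowerEnd-≥h : (J : Ideal) → h ≤ proj₁ (proj₁ (proj₁ J))
  lowerEnd-≥h (J , J⊆I) = proj₁ (J⊆I _ (lowerEnd-∈ {w = w} J))

  window-within-block : ∀ {h′ j′ i′ y} → Range h′ j′ ⊆ Range h j → (∀ x → Window w i′ j′ x → Range h′ j′ x)
    → y < n → Range i′ j′ y → Range i j y
  window-within-block {j′ = j′} {i′} J⊆I window⊆J y<n y∈ =
    subst (Range i j) (toℕ-fromℕ< y<n)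
      (position∈block t (J⊆I _ (window⊆J _ (t , subst (Range i′ j′) (sym (toℕ-fromℕ< y<n)) y∈ , refl))))
    where
    t : Fin n
    t = fromℕ< y<n

  restrict-interval : ∀ {h′ j′ c i′} → i + c ≡ i′ → h ≤ h′ → c + j′ ≤ j
    → (∀ x → (Range h′ j′ x → Window w i′ j′ x) × (Window w i′ j′ x → Range h′ j′ x))
    → IsNonemptyInterval u (h′ ∸ h) j′
  restrict-interval {h′} {j′} {c} refl h≤h′ c+j′≤j J≐window =
    c , subst (c + j′ <_) (sym m≡1+j) (s≤s c+j′≤j) , λ v → to v , from v
    where
    to : ∀ v → Range (h′ ∸ h) j′ v → Window u c j′ v
    to v v∈ with window-w⇒u c+j′≤j (proj₁ (J≐window (h + v)) (Range-∸⁺ h≤h′ v∈))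
    ... | v′ , h+v≡h+v′ , v′∈ = subst (Window u c j′) (sym (+-cancelˡ-≡ h _ _ h+v≡h+v′)) v′∈
    from : ∀ v → Window u c j′ v → Range (h′ ∸ h) j′ v
    from v v∈ = Range-∸⁻ h≤h′ (proj₂ (J≐window (h + v)) (window-u⇒w v∈))

  restrict : Ideal → Interval u
  restrict (((h′ , j′) , (i′ , i′+j′<n , J≐window)) , J⊆I) =
    (h′ ∸ h , j′) ,
    restrict-interval (m+[n∸m]≡n i≤i′) (proj₁ (J⊆I h′ (Range-start h′ j′))) c+j′≤j J≐window
    where
    within : ∀ {y} → y < n → Range i′ j′ y → Range i j y
    within = window-within-block J⊆I (λ x → proj₂ (J≐window x))
    i≤i′ : i ≤ i′
    i≤i′ = proj₁ (within (≤-<-trans (m≤m+n i′ j′) i′+j′<n) (Range-start i′ j′))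
    i+[c+j′]≡i′+j′ : i + ((i′ ∸ i) + j′) ≡ i′ + j′
    i+[c+j′]≡i′+j′ = trans (sym (+-assoc i (i′ ∸ i) j′)) (cong (_+ j′) (m+[n∸m]≡n i≤i′))
    c+j′≤j : (i′ ∸ i) + j′ ≤ j
    c+j′≤j = +-cancelˡ-≤ i _ _ (subst (_≤ i + j) (sym i+[c+j′]≡i′+j′) (proj₂ (within i′+j′<n (Range-end i′ j′))))

  extend : Interval u → Ideal
  extend ((a , b) , (c , c+b<m , K≐window)) =
    ((h + a , b) , (i + c , i+c+b<n , λ x → to x , from x)) , Range-⊆ a+b≤j
    where
    c+b≤j : c + b ≤ j
    c+b≤j = ≤-pred (subst (c + b <_) m≡1+j c+b<m)
    a+b≤j : a + b ≤ j
    a+b≤j with proj₁ (K≐window (a + b)) (Range-end a b)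
    ... | k , _ , U[k]≡a+b = ≤-pred (subst₂ _<_ U[k]≡a+b m≡1+j (toℕ<n (u ⟨$⟩ʳ k)))
    i+c+b<n : i + c + b < n
    i+c+b<n = subst (_< n) (trans (position-p k) (trans (cong (i +_) (toℕ-fromℕ< c+b<m)) (sym (+-assoc i c b))))
                (toℕ<n (p k))
      where
      k : Fin m
      k = fromℕ< c+b<m
    to : ∀ x → Range (h + a) b x → Window w (i + c) b x
    to x x∈ with m≤n⇒∃[o]m+o≡n (≤-trans (m≤m+n h a) (proj₁ x∈))
    ... | v , refl = window-u⇒w (proj₁ (K≐window v) (Range-+⁻ h x∈))
    from : ∀ x → Window w (i + c) b x → Range (h + a) b x
    from x x∈ with window-w⇒u c+b≤j x∈
    ... | v , refl , v∈ = Range-+⁺ h (proj₂ (K≐window v) v∈)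

  restrict-mono : ∀ J K → _≤IP_ {w = w} {I = I} J K → _≤P_ {w = u} (restrict J) (restrict K)
  restrict-mono J K J⊆K v v∈ = Range-∸⁻ (lowerEnd-≥h K) (J⊆K (h + v) (Range-∸⁺ (lowerEnd-≥h J) v∈))

  restrict-cancel : ∀ J K → _≤P_ {w = u} (restrict J) (restrict K) → _≤IP_ {w = w} {I = I} J K
  restrict-cancel J K fJ⊆fK x x∈J =
    subst (⟦_⟧ {w = w} (proj₁ K)) h+[x∸h]≡x
      (Range-∸⁺ (lowerEnd-≥h K) (fJ⊆fK (x ∸ h)
        (Range-∸⁻ (lowerEnd-≥h J) (subst (⟦_⟧ {w = w} (proj₁ J)) (sym h+[x∸h]≡x) x∈J))))
    where
    h+[x∸h]≡x : h + (x ∸ h) ≡ x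
    h+[x∸h]≡x = m+[n∸m]≡n (proj₁ (proj₂ J x x∈J))

  restrict-extend : ∀ K → _≤P_ {w = u} (restrict (extend K)) K × _≤P_ {w = u} K (restrict (extend K))
  restrict-extend ((a , b) , _) =
    (λ v → subst (λ z → Range z b v) (m+n∸m≡n h a)) , (λ v → subst (λ z → Range z b v) (sym (m+n∸m≡n h a)))

  restrict-isOrderIsomorphism :
    IsOrderIsomorphism (_≈IP_ {w = w} {I = I}) (_≈P_ {w = u}) (_≤IP_ {w = w} {I = I}) (_≤P_ {w = u}) restrict
  restrict-isOrderIsomorphism = isOrderIsomorphism-fromRightInverse restrict extend
    (λ J⊆K K⊆L → ⊆-trans J⊆K K⊆L) restrict-mono restrict-cancel restrict-extend

lemma2p2 : ∀ {n} (w : Permutation′ n) (I : Interval w) (m : ℕ) (u : Permutation′ m)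
           → m ≡ card {w = w} I
           → IsPatternOf w I u
           → (∃ λ (f : IdealP {w = w} I → Interval u)
                → IsOrderIsomorphism (_≈IP_ {w = w} {I = I}) (_≈P_ {w = u})
                                     (_≤IP_ {w = w} {I = I}) (_≤P_ {w = u}) f)
             × (∃ λ (g : IdealP̄ {w = w} I → PBar u)
                → IsOrderIsomorphism (_≈IP̄_ {w = w} {I = I}) (_≈P̄_ {w = u})
                                     (_≤IP̄_ {w = w} {I = I}) (_≤P̄_ {w = u}) g)
lemma2p2 w ((h , j) , I-interval) m u m≡j+1 u-isPattern =
  (restrict , restrict-isOrderIsomorphism) ,
  (adjoin-0̂ {I = I} restrict , adjoin-0̂-isOrderIsomorphism restrict restrict-isOrderIsomorphism)
  where open Block w u h j I-interval (trans m≡j+1 (+-comm j 1)) u-isPattern
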